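{- Let $d$ be a power of $2$, let $X\subseteq\{0,1\}^d$ be a finite set, let $T$ be any quadtree and let $G\in\mathcal{G}_T(X)$ be any depth-greedy spanning tree. Then $\mathrm{Value}_T(X)\ge\mathrm{Cost}(G)/2\ge\mathsf{MST}(X)/2$.
   Context: Let $h=\log_2(2d)$. A quadtree is a rooted tree $T$ of depth $h$; each internal node at depth $j<h$ is labelled with an ordered tuple $(i_1,\dots,i_{2^j})\in[d]^{2^j}$ and has $2^{2^j}$ children indexed by $\{0,1\}^{2^j}$; nodes at depth $h-1$ are labelled $(1,\dots,d)$. A point $x$ determines a root-to-leaf path $\mathsf{v}_0(x),\dots,\mathsf{v}_h(x)$: from a node at depth $j$ labelled $(i_1,\dots,i_{2^j})$ go to its $(x_{i_1},\dots,x_{i_{2^j}})$-child. For a node $v$ at depth $i$, $X_v=\{x\in X:\mathsf{v}_i(x)=v\}$; $L_i$ is the set of depth-$i$ nodes with $X_v\neq\emptyset$; $\pi(v)$ is the parent of $v$. For an edge $(u,v)$, $\mathrm{avg}_{u,v}=\mathbb{E}_{c\sim X_u,c'\sim X_v}\|c-c'\|_1$ (uniform), $0$ if $X_v=\emptyset$. $\mathrm{Value}_T(X)=\sum_{i=1}^{h}\mathbf{1}\{|L_i|>1\}\sum_{v\in L_i}\mathrm{avg}_{\pi(v),v}$. For a DFS walk of $T$ from the root, let $\sigma:[n]\to X$ ($n=|X|$) order the points by the order their leaves are encountered; the associated spanning tree has edges $\{(\sigma(i),\sigma(i+1))\}_{i\in[n-1]}$; $\mathcal{G}_T(X)$ is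 the set of all such trees. $\mathrm{Cost}(G)=\sum_{(a,b)\in E(G)}\|a-b\|_1$; $\mathsf{MST}(X)$ is its minimum over spanning trees. -}

module Defs where

open import Data.Nat using (ℕ; zero; suc; _+_; _*_; _∸_; _^_; _<ᵇ_)
open import Data.Bool using (Bool; true; false; if_then_else_; _xor_)
import Data.Bool.Properties as BP
open import Data.Fin using (Fin)
open import Data.Vec using (Vec; []; _∷_; lookup; allFin; toList)
import Data.Vec as V
import Data.Vec.Properties as VP
open import Data.Nat.ListAction using (sum)
open import Data.List using (List; []; _∷_; length; null; concatMap; filter; zip; drop; applyUpTo)
import Data.List as L
open import Data.List.Relation.Binary.Permutation.Propositional using (_↭_)
open import Data.List.Membership.Propositional using (_∈_)
open import Data.List.Relation.Unary.All using (All)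
open import Data.Product using (Σ; _×_; _,_)
open import Data.Sum using (_⊎_)
open import Data.Unit using (⊤)
open import Data.Integer using (+_)
open import Data.Rational using (ℚ; 0ℚ)
import Data.Rational as Q
open import Relation.Binary.PropositionalEquality using (_≡_)
open import Relation.Binary.Construct.Closure.ReflexiveTransitive using (Star)

-- Points of {0,1}^d and the ℓ1 distance (= Hamming distance on {0,1}^d)

Pt : ℕ → Set
Pt d = Vec Bool d

dist : ∀ {d} → Pt d → Pt d → ℕ
dist [] [] = 0
dist (a ∷ as) (b ∷ bs) = (if a xor b then 1 else 0) + dist as bs

-- QT d j r : a (full) subtree whose root is at depth j, with r further levels.

data QT (d : ℕ) : ℕ → ℕ → Set where
  leaf : ∀ {j} → QT d j 0
  node : ∀ {j r} → Vec (Fin d) (2 ^ j)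
       → (Vec Bool (2 ^ j) → QT d (suc j) r) → QT d j (suc r)

-- A quadtree for d = 2^k has depth h = log₂(2d) = k + 1.
Quadtree : ℕ → Set
Quadtree k = QT (2 ^ k) 0 (suc k)

-- Nodes at depth h-1 (i.e. with exactly one level below) are labelled (1,…,d).
WellLabelled : ∀ {d j r} → QT d j r → Set
WellLabelled leaf = ⊤
WellLabelled {d} (node {r = zero} lab ch) = toList lab ≡ toList (allFin d)
WellLabelled (node {r = suc r} lab ch) = ∀ c → WellLabelled (ch c)

allVecs : (m : ℕ) → List (Vec Bool m)
allVecs zero = [] ∷ []
allVecs (suc m) = concatMap (λ v → (false ∷ v) ∷ (true ∷ v) ∷ []) (allVecs m)

childPts : ∀ {d m} → Vec (Fin d) m → Vec Bool m → List (Pt d) → List (Pt d)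
childPts lab c S = filter (λ x → VP.≡-dec BP._≟_ (V.map (lookup x) lab) c) S

-- avg_{u,v} = E_{c ~ X_u, c' ~ X_v} ‖c - c'‖₁  (0 if one of them is empty)

avg : ∀ {d} → List (Pt d) → List (Pt d) → ℚ
avg S U with length S * length U
... | zero  = 0ℚ
... | suc n = (+ sum (L.map (λ a → sum (L.map (dist a) U)) S)) Q./ suc n

-- For a subtree rooted at u with point set S = X_u, `pairs t S i` lists the pairs
-- (X_{π(v)}, X_v) for all nodes v at (relative) depth i ≥ 1 below u with X_v ≠ ∅.
pairs : ∀ {d j r} → QT d j r → List (Pt d) → ℕ → List (List (Pt d) × List (Pt d))
pairs leaf S i = []
pairs (node lab ch) S zero = []
pairs {j = j} (node lab ch) S (suc zero) =
  L.map (λ c → S , childPts lab c S)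
        (filter (λ c → BP.T? (Data.Bool.not (null (childPts lab c S)))) (allVecs (2 ^ j)))
pairs {j = j} (node lab ch) S (suc (suc i)) =
  concatMap (λ c → pairs (ch c) (childPts lab c S) (suc i)) (allVecs (2 ^ j))

sumℚ : List ℚ → ℚ
sumℚ = L.foldr Q._+_ 0ℚ

-- Value_T(X) = Σ_{i=1}^{h} 1{|L_i| > 1} Σ_{v ∈ L_i} avg_{π(v),v}
levelTerm : ∀ {d r} → QT d 0 r → List (Pt d) → ℕ → ℚ
levelTerm T X i =
  if 1 <ᵇ length (pairs T X i)
  then sumℚ (L.map (λ p → avg (Data.Product.proj₁ p) (Data.Product.proj₂ p)) (pairs T X i))
  else 0ℚ

Value : ∀ {d r} → QT d 0 r → List (Pt d) → ℚ
Value {r = r} T X = sumℚ (L.map (levelTerm T X) (applyUpTo suc r))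

-- DFS orders: `DFSOrder t S σ` says that σ is the order in which the points of
-- S (= X_u for the root u of t) are met by some DFS walk of t, i.e. at every
-- internal node the children are visited in some order (a permutation of all
-- children) and each child's subtree is traversed completely before the next.

DFSOrder : ∀ {d j r} → QT d j r → List (Pt d) → List (Pt d) → Set
DFSOrder leaf S σ = σ ≡ S
DFSOrder {d} {j} (node lab ch) S σ =
  Σ (List (Vec Bool (2 ^ j))) λ ord → ord ↭ allVecs (2 ^ j) ×
  Σ (Vec Bool (2 ^ j) → List (Pt d)) λ f →
    (∀ c → DFSOrder (ch c) (childPts lab c S) (f c)) × σ ≡ concatMap f ord

Edges : ℕ → Set
Edges d = List (Pt d × Pt d)

Cost : ∀ {d} → Edges d → ℕ
Cost E = sum (L.map (λ e → dist (Data.Product.proj₁ e) (Data.Product.proj₂ e)) E)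

pathEdges : ∀ {d} → List (Pt d) → Edges d
pathEdges σ = zip σ (drop 1 σ)

InGT : ∀ {d r} → QT d 0 r → List (Pt d) → Edges d → Set
InGT {d} T X G = Σ (List (Pt d)) λ σ → DFSOrder T X σ × G ≡ pathEdges σ

Adj : ∀ {d} → Edges d → Pt d → Pt d → Set
Adj E a b = ((a , b) ∈ E) ⊎ ((b , a) ∈ E)

IsSpanningTree : ∀ {d} → List (Pt d) → Edges d → Set
IsSpanningTree X E =
  All (λ e → (Data.Product.proj₁ e ∈ X) × (Data.Product.proj₂ e ∈ X)) E ×
  length E ≡ length X ∸ 1 ×
  (∀ {a b} → a ∈ X → b ∈ X → Star (Adj E) a b)

IsMSTCost : ∀ {d} → List (Pt d) → ℕ → Set
IsMSTCost {d} X m =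
  (Σ (Edges d) λ E → IsSpanningTree X E × Cost E ≡ m) ×
  (∀ E → IsSpanningTree X E → m Data.Nat.≤ Cost E)

-- Fix a DFS order σ and a node u. Consider the walk that starts at a uniformly random point
-- of X_u, runs through the part of σ inside X_u, and ends at another uniformly random point of
-- X_u. Its expected cost is at most twice the sum of avg over the edges below u: the walks of
-- the children are joined by paying each connecting edge through a random point of X_u
-- (triangle inequality), and re-drawing the endpoints of a child v from X_u instead of X_v
-- costs avg_{u,v} at each end. In Value_T the indicator 1{|L_i| > 1} only discards levels
-- above the first node with two occupied children; from there down every level has at least
-- two occupied nodes, so Cost(G) ≤ 2 Value_T(X).

module Submission where

open import Defs
open import Data.Nat using (ℕ; _^_)
open import Data.List using (List)
open import Data.List.Relation.Unary.Unique.Propositional using (Unique)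
open import Data.Product using (_×_)
open import Data.Integer using (+_)
open import Data.Rational using (_≤_; _/_)

open import Algebra.Bundles using (CommutativeMonoid)
import Algebra.Properties.CommutativeSemigroup as CommutativeSemigroupProperties
open import Data.Bool using (Bool; true; false; _xor_; if_then_else_; not; T)
import Data.Bool.Properties as BP
open import Data.Empty using (⊥-elim)
open import Data.Fin using (Fin)
import Data.Integer as ℤ
import Data.Integer.Properties as ℤP
open import Data.List as L using ([]; _∷_; length; _++_; concatMap; filter; applyUpTo)
import Data.List.Properties as LP
open import Data.List.Membership.Propositional using (_∈_)
open import Data.List.Membership.Propositional.Properties
  using (∈-filter⁺; ∈-filter⁻; ∈-length; ∈-concatMap⁺)
open import Data.List.Relation.Binary.Permutation.Propositional as ↭
  using (_↭_; prep; swap; ↭⇒↭ₛ)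
import Data.List.Relation.Binary.Permutation.Propositional.Properties as ↭ₚ
open import Data.List.Relation.Binary.Permutation.Setoid.Properties using (foldr-commMonoid)
open import Data.List.Relation.Unary.All as All using (All)
open import Data.List.Relation.Unary.AllPairs as AllPairs using ()
open import Data.List.Relation.Unary.Any as Any using (here; there)
open import Data.Nat as N using (zero; suc; z≤n; s≤s)
import Data.Nat.Properties as NP
open import Data.Nat.ListAction using (sum)
open import Data.Nat.Tactic.RingSolver using (solve-∀)
open import Data.Product using (_,_; proj₁; proj₂)
open import Data.Rational as Q using (ℚ; 0ℚ; toℚᵘ)
import Data.Rational.Properties as QP
open import Data.Rational.Solver using (module +-*-Solver)
open import Data.Rational.Unnormalised as U using (mkℚᵘ; *≤*)
import Data.Rational.Unnormalised.Properties as UP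
open import Data.Sum as Sum using (inj₁; inj₂)
open import Data.Unit using (tt)
open import Data.Vec as V using (Vec; []; _∷_; lookup; toList; allFin)
import Data.Vec.Properties as VP
open import Function using (_∘_; id)
open import Relation.Binary.Construct.Closure.ReflexiveTransitive as Star
  using (Star; ε; _◅_; _◅◅_)
open import Relation.Binary.PropositionalEquality
  using (_≡_; _≢_; refl; sym; trans; cong; cong₂; subst; subst₂; module ≡-Reasoning)
open import Relation.Nullary using (¬_; Dec; yes; no)

private
  variable
    A B : Set

  module ℕ+ = CommutativeSemigroupProperties NP.+-commutativeSemigroup
  module ℚ+ = CommutativeSemigroupProperties
    (CommutativeMonoid.commutativeSemigroup QP.+-0-commutativeMonoid)

-- Denominators are written as suc p so that no NonZero instance is involved.
frac : ℕ → ℕ → ℚ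
frac x p = + x / suc p

fromℕ : ℕ → ℚ
fromℕ n = frac n 0

toℚᵘ-frac : ∀ x p → toℚᵘ (frac x p) U.≃ mkℚᵘ (+ x) p
toℚᵘ-frac x p = QP.toℚᵘ-fromℚᵘ (mkℚᵘ (+ x) p)

frac-+ : ∀ y q z r →
  frac y q Q.+ frac z r ≡ frac (y N.* suc r N.+ z N.* suc q) (r N.+ q N.* suc r)
frac-+ y q z r = QP.toℚᵘ-injective (begin
  toℚᵘ (frac y q Q.+ frac z r)                     ≈⟨ QP.toℚᵘ-homo-+ (frac y q) (frac z r) ⟩
  toℚᵘ (frac y q) U.+ toℚᵘ (frac z r)              ≈⟨ UP.+-cong (toℚᵘ-frac y q) (toℚᵘ-frac z r) ⟩
  mkℚᵘ (+ y) q U.+ mkℚᵘ (+ z) r                    ≡⟨ cong₂ mkℚᵘ numerator refl ⟩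
  mkℚᵘ (+ (y N.* suc r N.+ z N.* suc q)) (r N.+ q N.* suc r)
                                                   ≈⟨ UP.≃-sym (toℚᵘ-frac _ _) ⟩
  toℚᵘ (frac (y N.* suc r N.+ z N.* suc q) (r N.+ q N.* suc r)) ∎)
  where
  open UP.≃-Reasoning
  numerator : + y ℤ.* + suc r ℤ.+ + z ℤ.* + suc q ≡ + (y N.* suc r N.+ z N.* suc q)
  numerator = trans (cong₂ ℤ._+_ (sym (ℤP.pos-* y (suc r))) (sym (ℤP.pos-* z (suc q))))
                    (sym (ℤP.pos-+ (y N.* suc r) (z N.* suc q)))

frac-≤ : ∀ x p y q → x N.* suc q N.≤ y N.* suc p → frac x p ≤ frac y q
frac-≤ x p y q h = QP.toℚᵘ-cancel-≤
  (UP.≤-respˡ-≃ (UP.≃-sym (toℚᵘ-frac x p)) (UP.≤-respʳ-≃ (UP.≃-sym (toℚᵘ-frac y q))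
    (*≤* (subst₂ ℤ._≤_ (ℤP.pos-* x (suc q)) (ℤP.pos-* y (suc p)) (ℤ.+≤+ h)))))

frac-cross : ∀ x p y q → x N.* suc q ≡ y N.* suc p → frac x p ≡ frac y q
frac-cross x p y q e =
  QP.≤-antisym (frac-≤ x p y q (NP.≤-reflexive e)) (frac-≤ y q x p (NP.≤-reflexive (sym e)))

frac-≤-+ : ∀ x p y q z r →
  x N.* (suc q N.* suc r) N.≤ (y N.* suc r N.+ z N.* suc q) N.* suc p →
  frac x p ≤ frac y q Q.+ frac z r
frac-≤-+ x p y q z r h = subst (frac x p ≤_) (sym (frac-+ y q z r))
  (frac-≤ x p (y N.* suc r N.+ z N.* suc q) (r N.+ q N.* suc r) h)

frac-nonneg : ∀ x p → 0ℚ ≤ frac x p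
frac-nonneg x p = frac-≤ 0 0 x p z≤n

fromℕ-+ : ∀ a b → fromℕ (a N.+ b) ≡ fromℕ a Q.+ fromℕ b
fromℕ-+ a b = sym (trans (frac-+ a 0 b 0)
  (cong (λ n → frac n 0) (cong₂ N._+_ (NP.*-identityʳ a) (NP.*-identityʳ b))))

half-+-half : ∀ c → frac c 1 Q.+ frac c 1 ≡ fromℕ c
half-+-half c = trans (frac-+ c 1 c 1) (frac-cross (c N.* 2 N.+ c N.* 2) 3 c 0 (identity c))
  where
  identity : ∀ c → (c N.* 2 N.+ c N.* 2) N.* 1 ≡ c N.* 4
  identity = solve-∀

+-self-cancel-≤ : ∀ {p q} → p Q.+ p ≤ q Q.+ q → p ≤ q
+-self-cancel-≤ h =
  QP.≮⇒≥ (λ q<p → QP.<-irrefl refl (QP.<-≤-trans (QP.+-mono-< q<p q<p) h))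

half-≤ : ∀ c {q} → fromℕ c ≤ q Q.+ q → frac c 1 ≤ q
half-≤ c {q} h = +-self-cancel-≤ (subst (_≤ q Q.+ q) (sym (half-+-half c)) h)

sumOf : (A → ℚ) → L.List A → ℚ
sumOf f xs = sumℚ (L.map f xs)

sumOf-mono : ∀ {f g : A → ℚ} xs → (∀ x → f x ≤ g x) → sumOf f xs ≤ sumOf g xs
sumOf-mono []       h = QP.≤-refl
sumOf-mono (x ∷ xs) h = QP.+-mono-≤ (h x) (sumOf-mono xs h)

sumOf-nonneg : ∀ {f : A → ℚ} xs → (∀ x → 0ℚ ≤ f x) → 0ℚ ≤ sumOf f xs
sumOf-nonneg []       h = QP.≤-refl
sumOf-nonneg (x ∷ xs) h = QP.+-mono-≤ (h x) (sumOf-nonneg xs h)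

sumOf-zero : (xs : L.List A) → sumOf (λ _ → 0ℚ) xs ≡ 0ℚ
sumOf-zero []       = refl
sumOf-zero (x ∷ xs) = cong (0ℚ Q.+_) (sumOf-zero xs)

sumOf-+ : ∀ (f g : A → ℚ) xs → sumOf (λ x → f x Q.+ g x) xs ≡ sumOf f xs Q.+ sumOf g xs
sumOf-+ f g []       = refl
sumOf-+ f g (x ∷ xs) = trans (cong ((f x Q.+ g x) Q.+_) (sumOf-+ f g xs))
                             (ℚ+.interchange (f x) (g x) (sumOf f xs) (sumOf g xs))

sumOf-++ : ∀ (f : A → ℚ) xs ys → sumOf f (xs ++ ys) ≡ sumOf f xs Q.+ sumOf f ys
sumOf-++ f []       ys = sym (QP.+-identityˡ _)
sumOf-++ f (x ∷ xs) ys = trans (cong (f x Q.+_) (sumOf-++ f xs ys)) (sym (QP.+-assoc (f x) _ _))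

sumOf-concatMap : ∀ (f : B → ℚ) (g : A → L.List B) xs →
  sumOf f (concatMap g xs) ≡ sumOf (sumOf f ∘ g) xs
sumOf-concatMap f g []       = refl
sumOf-concatMap f g (x ∷ xs) =
  trans (sumOf-++ f (g x) (concatMap g xs)) (cong (sumOf f (g x) Q.+_) (sumOf-concatMap f g xs))

sumOf-map : ∀ (f : B → ℚ) (g : A → B) xs → sumOf f (L.map g xs) ≡ sumOf (f ∘ g) xs
sumOf-map f g xs = cong sumℚ (sym (LP.map-∘ xs))

sumOf-filter : ∀ {P : A → Set} (P? : ∀ x → Dec (P x)) (f : A → ℚ) xs →
  (∀ x → ¬ P x → f x ≡ 0ℚ) → sumOf f (filter P? xs) ≡ sumOf f xs
sumOf-filter P? f []       h = refl
sumOf-filter P? f (x ∷ xs) h with P? x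
... | yes _  = cong (f x Q.+_) (sumOf-filter P? f xs h)
... | no ¬px = begin
  sumOf f (filter P? xs)  ≡⟨ sumOf-filter P? f xs h ⟩
  sumOf f xs              ≡⟨ QP.+-identityˡ _ ⟨
  0ℚ Q.+ sumOf f xs       ≡⟨ cong (Q._+ sumOf f xs) (h x ¬px) ⟨
  f x Q.+ sumOf f xs      ∎
  where open ≡-Reasoning

sumOf-↭ : ∀ (f : A → ℚ) {xs ys} → xs ↭ ys → sumOf f xs ≡ sumOf f ys
sumOf-↭ f p = foldr-commMonoid ℚ+0.setoid ℚ+0.isCommutativeMonoid (↭⇒↭ₛ (↭ₚ.map⁺ f p))
  where module ℚ+0 = CommutativeMonoid QP.+-0-commutativeMonoid

sumUpTo : (ℕ → ℚ) → ℕ → ℚ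
sumUpTo f n = sumℚ (applyUpTo f n)

map-applyUpTo : ∀ (f : A → B) (g : ℕ → A) n → L.map f (applyUpTo g n) ≡ applyUpTo (f ∘ g) n
map-applyUpTo f g zero    = refl
map-applyUpTo f g (suc n) = cong (f (g 0) ∷_) (map-applyUpTo f (g ∘ suc) n)

sumUpTo-cong : ∀ {f g : ℕ → ℚ} n → (∀ i → i N.< n → f i ≡ g i) → sumUpTo f n ≡ sumUpTo g n
sumUpTo-cong zero    h = refl
sumUpTo-cong (suc n) h = cong₂ Q._+_ (h 0 (s≤s z≤n)) (sumUpTo-cong n (λ i i<n → h (suc i) (s≤s i<n)))

sumUpTo-nonneg : ∀ {f : ℕ → ℚ} n → (∀ i → 0ℚ ≤ f i) → 0ℚ ≤ sumUpTo f n
sumUpTo-nonneg zero    h = QP.≤-refl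
sumUpTo-nonneg (suc n) h = QP.+-mono-≤ (h 0) (sumUpTo-nonneg n (h ∘ suc))

sumUpTo-sumOf-comm : ∀ (F : A → ℕ → ℚ) xs n →
  sumUpTo (λ i → sumOf (λ x → F x i) xs) n ≡ sumOf (λ x → sumUpTo (F x) n) xs
sumUpTo-sumOf-comm F xs zero    = sym (sumOf-zero xs)
sumUpTo-sumOf-comm F xs (suc n) =
  trans (cong (sumOf (λ x → F x 0) xs Q.+_) (sumUpTo-sumOf-comm (λ x → F x ∘ suc) xs n))
        (sym (sumOf-+ (λ x → F x 0) (λ x → sumUpTo (F x ∘ suc) n) xs))

bit : Bool → ℕ
bit b = if b then 1 else 0

bit-triangle : ∀ x y z → bit (x xor z) N.≤ bit (x xor y) N.+ bit (y xor z)
bit-triangle false false false = z≤n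
bit-triangle false false true  = s≤s z≤n
bit-triangle false true  false = z≤n
bit-triangle false true  true  = s≤s z≤n
bit-triangle true  false false = s≤s z≤n
bit-triangle true  false true  = z≤n
bit-triangle true  true  false = s≤s z≤n
bit-triangle true  true  true  = z≤n

dist-comm : ∀ {d} (a b : Pt d) → dist a b ≡ dist b a
dist-comm []      []      = refl
dist-comm (x ∷ a) (y ∷ b) = cong₂ N._+_ (cong bit (BP.xor-comm x y)) (dist-comm a b)

dist-self : ∀ {d} (a : Pt d) → dist a a ≡ 0
dist-self []      = refl
dist-self (x ∷ a) = cong₂ N._+_ (cong bit (BP.xor-same x)) (dist-self a)

dist-triangle : ∀ {d} (a b c : Pt d) → dist a c N.≤ dist a b N.+ dist b c
dist-triangle []      []      []      = z≤n
dist-triangle (x ∷ a) (y ∷ b) (z ∷ c) = NP.≤-trans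
  (NP.+-mono-≤ (bit-triangle x y z) (dist-triangle a b c))
  (NP.≤-reflexive (ℕ+.interchange (bit (x xor y)) (bit (y xor z)) (dist a b) (dist b c)))

distSum : ∀ {d} → Pt d → L.List (Pt d) → ℕ
distSum a P = sum (L.map (dist a) P)

crossSum : ∀ {d} → L.List (Pt d) → L.List (Pt d) → ℕ
crossSum P U = sum (L.map (λ a → distSum a U) P)

distSum-triangle : ∀ {d} (a b : Pt d) U → length U N.* dist a b N.≤ distSum a U N.+ distSum b U
distSum-triangle a b []      = z≤n
distSum-triangle a b (u ∷ U) = begin
  dist a b N.+ length U N.* dist a b
    ≤⟨ NP.+-mono-≤ (dist-triangle a u b) (distSum-triangle a b U) ⟩
  (dist a u N.+ dist u b) N.+ (distSum a U N.+ distSum b U)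
    ≡⟨ cong (λ e → (dist a u N.+ e) N.+ (distSum a U N.+ distSum b U)) (dist-comm u b) ⟩
  (dist a u N.+ dist b u) N.+ (distSum a U N.+ distSum b U)
    ≡⟨ ℕ+.interchange (dist a u) (dist b u) (distSum a U) (distSum b U) ⟩
  distSum a (u ∷ U) N.+ distSum b (u ∷ U) ∎
  where open NP.≤-Reasoning

distSum-shift : ∀ {d} (a : Pt d) P U →
  distSum a P N.* length U N.≤ length P N.* distSum a U N.+ crossSum P U
distSum-shift a []      U = z≤n
distSum-shift a (p ∷ P) U = begin
  (dist a p N.+ distSum a P) N.* length U
    ≡⟨ NP.*-distribʳ-+ (length U) (dist a p) (distSum a P) ⟩
  dist a p N.* length U N.+ distSum a P N.* length U
    ≡⟨ cong (N._+ distSum a P N.* length U) (NP.*-comm (dist a p) (length U)) ⟩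
  length U N.* dist a p N.+ distSum a P N.* length U
    ≤⟨ NP.+-mono-≤ (distSum-triangle a p U) (distSum-shift a P U) ⟩
  (distSum a U N.+ distSum p U) N.+ (length P N.* distSum a U N.+ crossSum P U)
    ≡⟨ ℕ+.interchange (distSum a U) (distSum p U) (length P N.* distSum a U) (crossSum P U) ⟩
  length (p ∷ P) N.* distSum a U N.+ crossSum (p ∷ P) U ∎
  where open NP.≤-Reasoning

meanDist : ∀ {d} → Pt d → L.List (Pt d) → ℚ
meanDist a []       = 0ℚ
meanDist a (p ∷ ps) = frac (distSum a (p ∷ ps)) (length ps)

meanDist-nonneg : ∀ {d} (a : Pt d) P → 0ℚ ≤ meanDist a P
meanDist-nonneg a []       = QP.≤-refl
meanDist-nonneg a (p ∷ ps) = frac-nonneg (distSum a (p ∷ ps)) (length ps)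

avg-empty : ∀ {d} (S : L.List (Pt d)) → avg S [] ≡ 0ℚ
avg-empty []      = refl
avg-empty (x ∷ S) rewrite NP.*-zeroʳ (length S) = refl

avg-nonneg : ∀ {d} (S U : L.List (Pt d)) → 0ℚ ≤ avg S U
avg-nonneg []      U       = QP.≤-refl
avg-nonneg (x ∷ S) []      = QP.≤-reflexive (sym (avg-empty (x ∷ S)))
avg-nonneg (x ∷ S) (u ∷ U) =
  frac-nonneg (crossSum (x ∷ S) (u ∷ U)) (length U N.+ length S N.* suc (length U))

dist≤meanDist+meanDist : ∀ {d} (a b : Pt d) P → 0 N.< length P →
  fromℕ (dist a b) ≤ meanDist a P Q.+ meanDist b P
dist≤meanDist+meanDist a b P@(p ∷ ps) _ = frac-≤-+ (dist a b) 0 Da n Db n (begin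
  dist a b N.* (suc n N.* suc n)    ≡⟨ NP.*-assoc (dist a b) (suc n) (suc n) ⟨
  dist a b N.* suc n N.* suc n      ≡⟨ cong (N._* suc n) (NP.*-comm (dist a b) (suc n)) ⟩
  length P N.* dist a b N.* suc n   ≤⟨ NP.*-monoˡ-≤ (suc n) (distSum-triangle a b P) ⟩
  (Da N.+ Db) N.* suc n             ≡⟨ NP.*-distribʳ-+ (suc n) Da Db ⟩
  Da N.* suc n N.+ Db N.* suc n     ≡⟨ NP.*-identityʳ _ ⟨
  (Da N.* suc n N.+ Db N.* suc n) N.* 1 ∎)
  where
  open NP.≤-Reasoning
  n = length ps
  Da = distSum a P
  Db = distSum b P

meanDist-shift : ∀ {d} (a : Pt d) P U → 0 N.< length P → 0 N.< length U →
  meanDist a P ≤ meanDist a U Q.+ avg P U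
meanDist-shift a P@(p ∷ ps) U@(u ∷ us) _ _ = frac-≤-+ Dp lp Du lu C m (begin
  Dp N.* (suc lu N.* suc m)                    ≡⟨ NP.*-assoc Dp (suc lu) (suc m) ⟨
  Dp N.* suc lu N.* suc m                      ≤⟨ NP.*-monoˡ-≤ (suc m) (distSum-shift a P U) ⟩
  (suc lp N.* Du N.+ C) N.* suc m              ≡⟨ regroup Du C lp lu ⟩
  (Du N.* suc m N.+ C N.* suc lu) N.* suc lp   ∎)
  where
  open NP.≤-Reasoning
  lp = length ps
  lu = length us
  m = lu N.+ lp N.* suc lu
  Dp = distSum a P
  Du = distSum a U
  C = crossSum P U
  regroup : ∀ Du C lp lu → ((1 N.+ lp) N.* Du N.+ C) N.* ((1 N.+ lp) N.* (1 N.+ lu))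
          ≡ (Du N.* ((1 N.+ lp) N.* (1 N.+ lu)) N.+ C N.* (1 N.+ lu)) N.* (1 N.+ lp)
  regroup = solve-∀

pathCost : ∀ {d} → L.List (Pt d) → ℕ
pathCost σ = Cost (pathEdges σ)

lastOf : ∀ {d} → Pt d → L.List (Pt d) → Pt d
lastOf x []       = x
lastOf x (y ∷ ys) = lastOf y ys

lastOf-∈ : ∀ {d} (x : Pt d) xs → lastOf x xs ∈ x ∷ xs
lastOf-∈ x []       = here refl
lastOf-∈ x (y ∷ ys) = there (lastOf-∈ y ys)

lastOf-++ : ∀ {d} (x : Pt d) xs y ys → lastOf x (xs ++ y ∷ ys) ≡ lastOf y ys
lastOf-++ x []       y ys = refl
lastOf-++ x (z ∷ zs) y ys = lastOf-++ z zs y ys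

pathCost-++ : ∀ {d} (x : Pt d) xs y ys →
  pathCost ((x ∷ xs) ++ y ∷ ys) ≡ pathCost (x ∷ xs) N.+ dist (lastOf x xs) y N.+ pathCost (y ∷ ys)
pathCost-++ x []       y ys = refl
pathCost-++ x (z ∷ zs) y ys = begin
  dist x z N.+ pathCost ((z ∷ zs) ++ y ∷ ys)
    ≡⟨ cong (dist x z N.+_) (pathCost-++ z zs y ys) ⟩
  dist x z N.+ (pathCost (z ∷ zs) N.+ dist (lastOf z zs) y N.+ pathCost (y ∷ ys))
    ≡⟨ NP.+-assoc (dist x z) _ (pathCost (y ∷ ys)) ⟨
  dist x z N.+ (pathCost (z ∷ zs) N.+ dist (lastOf z zs) y) N.+ pathCost (y ∷ ys)
    ≡⟨ cong (N._+ pathCost (y ∷ ys)) (NP.+-assoc (dist x z) (pathCost (z ∷ zs)) _) ⟨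
  dist x z N.+ pathCost (z ∷ zs) N.+ dist (lastOf z zs) y N.+ pathCost (y ∷ ys) ∎
  where open ≡-Reasoning

-- The expected cost of the walk p, σ, p′ for p and p′ drawn uniformly from P.
excursionCost : ∀ {d} → L.List (Pt d) → L.List (Pt d) → ℚ
excursionCost P []       = 0ℚ
excursionCost P (x ∷ xs) = fromℕ (pathCost (x ∷ xs)) Q.+ (meanDist x P Q.+ meanDist (lastOf x xs) P)

pathCost≤excursionCost : ∀ {d} (P σ : L.List (Pt d)) → fromℕ (pathCost σ) ≤ excursionCost P σ
pathCost≤excursionCost P []       = QP.≤-refl
pathCost≤excursionCost P (x ∷ xs) = QP.≤-trans (QP.≤-reflexive (sym (QP.+-identityʳ _)))
  (QP.+-monoʳ-≤ (fromℕ (pathCost (x ∷ xs))) (QP.+-mono-≤ (meanDist-nonneg x P) (meanDist-nonneg _ P)))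

excursionCost-++ : ∀ {d} (P : L.List (Pt d)) → 0 N.< length P → ∀ σ τ →
  excursionCost P (σ ++ τ) ≤ excursionCost P σ Q.+ excursionCost P τ
excursionCost-++ P _ []       τ = QP.≤-reflexive (sym (QP.+-identityˡ _))
excursionCost-++ P _ (x ∷ xs) [] rewrite LP.++-identityʳ xs = QP.≤-reflexive (sym (QP.+-identityʳ _))
excursionCost-++ P P≠[] (x ∷ xs) (y ∷ ys) = begin
  fromℕ (pathCost ((x ∷ xs) ++ y ∷ ys)) Q.+ (D x Q.+ D (lastOf x (xs ++ y ∷ ys)))
    ≡⟨ cong₂ (λ c l → fromℕ c Q.+ (D x Q.+ D l)) (pathCost-++ x xs y ys) (lastOf-++ x xs y ys) ⟩
  fromℕ (c₁ N.+ dist l₁ y N.+ c₂) Q.+ (D x Q.+ D l₂)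
    ≡⟨ cong (Q._+ (D x Q.+ D l₂)) (trans (fromℕ-+ (c₁ N.+ dist l₁ y) c₂)
                                         (cong (Q._+ fromℕ c₂) (fromℕ-+ c₁ (dist l₁ y)))) ⟩
  fromℕ c₁ Q.+ fromℕ (dist l₁ y) Q.+ fromℕ c₂ Q.+ (D x Q.+ D l₂)
    ≤⟨ QP.+-monoˡ-≤ (D x Q.+ D l₂) (QP.+-monoˡ-≤ (fromℕ c₂)
         (QP.+-monoʳ-≤ (fromℕ c₁) (dist≤meanDist+meanDist l₁ y P P≠[]))) ⟩
  fromℕ c₁ Q.+ (D l₁ Q.+ D y) Q.+ fromℕ c₂ Q.+ (D x Q.+ D l₂)
    ≡⟨ regroup (fromℕ c₁) (fromℕ c₂) (D x) (D l₁) (D y) (D l₂) ⟩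
  fromℕ c₁ Q.+ (D x Q.+ D l₁) Q.+ (fromℕ c₂ Q.+ (D y Q.+ D l₂)) ∎
  where
  open QP.≤-Reasoning
  D = λ a → meanDist a P
  c₁ = pathCost (x ∷ xs)
  c₂ = pathCost (y ∷ ys)
  l₁ = lastOf x xs
  l₂ = lastOf y ys
  regroup : ∀ c₁ c₂ dx dl₁ dy dl₂ →
    c₁ Q.+ (dl₁ Q.+ dy) Q.+ c₂ Q.+ (dx Q.+ dl₂) ≡ c₁ Q.+ (dx Q.+ dl₁) Q.+ (c₂ Q.+ (dy Q.+ dl₂))
  regroup = +-*-Solver.solve 6 (λ c₁ c₂ dx dl₁ dy dl₂ →
    c₁ :+ (dl₁ :+ dy) :+ c₂ :+ (dx :+ dl₂) := c₁ :+ (dx :+ dl₁) :+ (c₂ :+ (dy :+ dl₂))) refl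
    where open +-*-Solver

excursionCost-concatMap : ∀ {d} (P : L.List (Pt d)) → 0 N.< length P → ∀ (f : A → L.List (Pt d)) xs →
  excursionCost P (concatMap f xs) ≤ sumOf (excursionCost P ∘ f) xs
excursionCost-concatMap P P≠[] f []       = QP.≤-refl
excursionCost-concatMap P P≠[] f (x ∷ xs) = QP.≤-trans (excursionCost-++ P P≠[] (f x) (concatMap f xs))
  (QP.+-monoʳ-≤ (excursionCost P (f x)) (excursionCost-concatMap P P≠[] f xs))

excursionCost-shift : ∀ {d} (P U σ : L.List (Pt d)) → 0 N.< length P → (∀ {x} → x ∈ σ → x ∈ U) →
  excursionCost P σ ≤ (avg P U Q.+ avg P U) Q.+ excursionCost U σ
excursionCost-shift P U [] _ _ = QP.+-mono-≤ (QP.+-mono-≤ (avg-nonneg P U) (avg-nonneg P U)) QP.≤-refl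
excursionCost-shift P [] (x ∷ xs) _ σ⊆U with σ⊆U (here refl)
... | ()
excursionCost-shift P U@(_ ∷ _) (x ∷ xs) P≠[] _ = begin
  c Q.+ (meanDist x P Q.+ meanDist l P)
    ≤⟨ QP.+-monoʳ-≤ c (QP.+-mono-≤ (meanDist-shift x P U P≠[] (s≤s z≤n))
                                   (meanDist-shift l P U P≠[] (s≤s z≤n))) ⟩
  c Q.+ ((meanDist x U Q.+ a) Q.+ (meanDist l U Q.+ a))
    ≡⟨ regroup c (meanDist x U) (meanDist l U) a ⟩
  (a Q.+ a) Q.+ (c Q.+ (meanDist x U Q.+ meanDist l U)) ∎
  where
  open QP.≤-Reasoning
  c = fromℕ (pathCost (x ∷ xs))
  l = lastOf x xs
  a = avg P U
  regroup : ∀ c dx dl a → c Q.+ ((dx Q.+ a) Q.+ (dl Q.+ a)) ≡ (a Q.+ a) Q.+ (c Q.+ (dx Q.+ dl))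
  regroup = +-*-Solver.solve 4 (λ c dx dl a →
    c :+ ((dx :+ a) :+ (dl :+ a)) := (a :+ a) :+ (c :+ (dx :+ dl))) refl
    where open +-*-Solver

Homogeneous : ∀ {d} → L.List (Pt d) → Set
Homogeneous S = ∀ {x y} → x ∈ S → y ∈ S → x ≡ y

pathCost-homogeneous : ∀ {d} (σ : L.List (Pt d)) → Homogeneous σ → pathCost σ ≡ 0
pathCost-homogeneous []           h = refl
pathCost-homogeneous (x ∷ [])     h = refl
pathCost-homogeneous (x ∷ y ∷ ys) h = cong₂ N._+_
  (trans (cong (λ z → dist z y) (h (here refl) (there (here refl)))) (dist-self y))
  (pathCost-homogeneous (y ∷ ys) (λ p q → h (there p) (there q)))

distSum-homogeneous : ∀ {d} (a : Pt d) P → (∀ {b} → b ∈ P → a ≡ b) → distSum a P ≡ 0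
distSum-homogeneous a []      h = refl
distSum-homogeneous a (b ∷ P) h = cong₂ N._+_
  (trans (cong (dist a) (sym (h (here refl)))) (dist-self a))
  (distSum-homogeneous a P (h ∘ there))

excursionCost-homogeneous : ∀ {d} (S : L.List (Pt d)) → Homogeneous S → excursionCost S S ≤ 0ℚ
excursionCost-homogeneous []       h = QP.≤-refl
excursionCost-homogeneous (x ∷ xs) h = QP.+-mono-≤
  (QP.≤-reflexive (cong fromℕ (pathCost-homogeneous (x ∷ xs) h)))
  (QP.+-mono-≤ (meanDist≤0 (here refl)) (meanDist≤0 (lastOf-∈ x xs)))
  where
  meanDist≤0 : ∀ {y} → y ∈ x ∷ xs → meanDist y (x ∷ xs) ≤ 0ℚ
  meanDist≤0 y∈ = subst (λ s → frac s (length xs) ≤ 0ℚ)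
    (sym (distSum-homogeneous _ (x ∷ xs) (h y∈))) (frac-≤ 0 (length xs) 0 0 z≤n)

concatMap-[] : ∀ (g : A → L.List B) xs → (∀ x → g x ≡ []) → concatMap g xs ≡ []
concatMap-[] g []       h = refl
concatMap-[] g (x ∷ xs) h rewrite h x = concatMap-[] g xs h

concatMap-filter : ∀ {P : A → Set} (P? : ∀ x → Dec (P x)) (g : A → L.List B) xs →
  (∀ x → ¬ P x → g x ≡ []) → concatMap g (filter P? xs) ≡ concatMap g xs
concatMap-filter P? g []       h = refl
concatMap-filter P? g (x ∷ xs) h with P? x
... | yes _  = cong (g x ++_) (concatMap-filter P? g xs h)
... | no ¬px rewrite h x ¬px = concatMap-filter P? g xs h

null-≡[] : (xs : L.List A) → ¬ T (not (L.null xs)) → xs ≡ []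
null-≡[] []      _ = refl
null-≡[] (x ∷ _) h = ⊥-elim (h tt)

key : ∀ {d m} → Vec (Fin d) m → Pt d → Vec Bool m
key lab x = V.map (lookup x) lab

inChild? : ∀ {d m} (lab : Vec (Fin d) m) (c : Vec Bool m) (x : Pt d) → Dec (key lab x ≡ c)
inChild? lab c x = VP.≡-dec BP._≟_ (key lab x) c

occupied? : ∀ {d m} (lab : Vec (Fin d) m) S (c : Vec Bool m) → Dec (T (not (L.null (childPts lab c S))))
occupied? lab S c = BP.T? (not (L.null (childPts lab c S)))

occupiedChildren : ∀ {d m} → Vec (Fin d) m → L.List (Pt d) → L.List (Vec Bool m)
occupiedChildren {m = m} lab S = filter (occupied? lab S) (allVecs m)

avgPair : ∀ {d} → L.List (Pt d) × L.List (Pt d) → ℚ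
avgPair p = avg (proj₁ p) (proj₂ p)

levelSum : ∀ {d j r} → QT d j r → L.List (Pt d) → ℕ → ℚ
levelSum t S i = sumOf avgPair (pairs t S i)

gatedSum : ∀ {d} → L.List (L.List (Pt d) × L.List (Pt d)) → ℚ
gatedSum ps = if 1 N.<ᵇ length ps then sumOf avgPair ps else 0ℚ

-- Value_T for the subtree t with point set S; ungatedValue drops the factor 1{|L_i| > 1}.
value : ∀ {d j r} → QT d j r → L.List (Pt d) → ℚ
value {r = r} t S = sumUpTo (λ i → gatedSum (pairs t S (suc i))) r

ungatedValue : ∀ {d j r} → QT d j r → L.List (Pt d) → ℚ
ungatedValue {r = r} t S = sumUpTo (λ i → levelSum t S (suc i)) r

Value≡value : ∀ {d r} (T : QT d 0 r) X → Value T X ≡ value T X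
Value≡value {r = r} T X = cong sumℚ (map-applyUpTo (levelTerm T X) suc r)

ungatedValue-nonneg : ∀ {d j r} (t : QT d j r) S → 0ℚ ≤ ungatedValue t S
ungatedValue-nonneg {r = r} t S =
  sumUpTo-nonneg r (λ i → sumOf-nonneg (pairs t S (suc i)) (λ p → avg-nonneg (proj₁ p) (proj₂ p)))

value-nonneg : ∀ {d j r} (t : QT d j r) S → 0ℚ ≤ value t S
value-nonneg {r = r} t S = sumUpTo-nonneg r (λ i → gatedSum-nonneg (pairs t S (suc i)))
  where
  gatedSum-nonneg : ∀ ps → 0ℚ ≤ gatedSum ps
  gatedSum-nonneg ps with 1 N.<ᵇ length ps
  ... | true  = sumOf-nonneg ps (λ p → avg-nonneg (proj₁ p) (proj₂ p))
  ... | false = QP.≤-refl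

pairs-[] : ∀ {d j r} (t : QT d j r) i → pairs t [] i ≡ []
pairs-[] leaf          i             = refl
pairs-[] (node lab ch) zero          = refl
pairs-[] {j = j} (node lab ch) (suc zero) =
  cong (L.map (λ c → [] , childPts lab c []))
       (LP.filter-none (occupied? lab []) (All.universal (λ c ()) (allVecs (2 ^ j))))
pairs-[] {j = j} (node lab ch) (suc (suc i)) =
  concatMap-[] (λ c → pairs (ch c) [] (suc i)) (allVecs (2 ^ j)) (λ c → pairs-[] (ch c) (suc i))

toList-key : ∀ {d m} (lab : Vec (Fin d) m) → toList lab ≡ toList (allFin d) →
  ∀ x → toList (key lab x) ≡ toList x
toList-key {d} lab lab≡allFin x = begin
  toList (V.map (lookup x) lab)          ≡⟨ VP.toList-map (lookup x) lab ⟩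
  L.map (lookup x) (toList lab)          ≡⟨ cong (L.map (lookup x)) lab≡allFin ⟩
  L.map (lookup x) (toList (allFin d))   ≡⟨ VP.toList-map (lookup x) (allFin d) ⟨
  toList (V.map (lookup x) (allFin d))   ≡⟨ cong toList (VP.map-lookup-allFin x) ⟩
  toList x                               ∎
  where open ≡-Reasoning

key-injective : ∀ {d m} (lab : Vec (Fin d) m) → toList lab ≡ toList (allFin d) →
  ∀ x y → key lab x ≡ key lab y → x ≡ y
key-injective lab lab≡allFin x y eq = trans (sym (VP.cast-is-id refl x)) (VP.toList-injective refl x y
  (trans (sym (toList-key lab lab≡allFin x)) (trans (cong toList eq) (toList-key lab lab≡allFin y))))

childPts-homogeneous : ∀ {d m} (lab : Vec (Fin d) m) → toList lab ≡ toList (allFin d) →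
  ∀ c S → Homogeneous (childPts lab c S)
childPts-homogeneous lab lab≡allFin c S {x} {y} x∈ y∈ = key-injective lab lab≡allFin x y
  (trans (proj₂ (∈-filter⁻ (inChild? lab c) {xs = S} x∈))
         (sym (proj₂ (∈-filter⁻ (inChild? lab c) {xs = S} y∈))))

-- At a leaf all points coincide, because its parent's label lists every coordinate.
Admissible : ∀ {d j r} → QT d j r → L.List (Pt d) → Set
Admissible leaf                          S = Homogeneous S
Admissible {d} (node {r = zero} lab ch)  S = toList lab ≡ toList (allFin d)
Admissible (node {r = suc r} lab ch)     S = ∀ c → Admissible (ch c) (childPts lab c S)

wellLabelled⇒admissible : ∀ {d j r} (t : QT d j (suc r)) → WellLabelled t → ∀ S → Admissible t S
wellLabelled⇒admissible (node {r = zero} lab ch)  wl S = wl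
wellLabelled⇒admissible (node {r = suc r} lab ch) wl S c =
  wellLabelled⇒admissible (ch c) (wl c) (childPts lab c S)

admissible-child : ∀ {d j r} (lab : Vec (Fin d) (2 ^ j)) (ch : Vec Bool (2 ^ j) → QT d (suc j) r) S →
  Admissible (node lab ch) S → ∀ c → Admissible (ch c) (childPts lab c S)
admissible-child {r = zero} lab ch S adm c with ch c
... | leaf = childPts-homogeneous lab adm c S
admissible-child {r = suc r} lab ch S adm c = adm c

allVecs-complete : ∀ m (c : Vec Bool m) → c ∈ allVecs m
allVecs-complete zero    []      = here refl
allVecs-complete (suc m) (b ∷ c) =
  ∈-concatMap⁺ (λ v → (false ∷ v) ∷ (true ∷ v) ∷ []) {xs = allVecs m}
               (Any.map (λ { refl → extend b }) (allVecs-complete m c))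
  where
  extend : ∀ b → (b ∷ c) ∈ (false ∷ c) ∷ (true ∷ c) ∷ []
  extend false = here refl
  extend true  = there (here refl)

allVecs-unique : ∀ m → Unique (allVecs m)
allVecs-unique zero    = All.[] AllPairs.∷ AllPairs.[]
allVecs-unique (suc m) = extend-unique (allVecs m) (allVecs-unique m)
  where
  extend-fresh : ∀ b (v : Vec Bool m) vs → All (v ≢_) vs →
    All ((b ∷ v) ≢_) (concatMap (λ w → (false ∷ w) ∷ (true ∷ w) ∷ []) vs)
  extend-fresh b v []       _           = All.[]
  extend-fresh b v (w ∷ ws) (v≢w All.∷ fresh) =
    (v≢w ∘ VP.∷-injectiveʳ) All.∷ (v≢w ∘ VP.∷-injectiveʳ) All.∷ extend-fresh b v ws fresh
  extend-unique : ∀ vs → Unique vs → Unique (concatMap (λ w → (false ∷ w) ∷ (true ∷ w) ∷ []) vs)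
  extend-unique []       _ = AllPairs.[]
  extend-unique (v ∷ vs) (fresh AllPairs.∷ unique) =
    ((λ ()) All.∷ extend-fresh false v vs fresh)
      AllPairs.∷ (extend-fresh true v vs fresh AllPairs.∷ extend-unique vs unique)

concatMap-cong-↭ : ∀ (f g : A → L.List B) xs → (∀ x → f x ↭ g x) → concatMap f xs ↭ concatMap g xs
concatMap-cong-↭ f g []       h = ↭.refl
concatMap-cong-↭ f g (x ∷ xs) h = ↭ₚ.++⁺ (h x) (concatMap-cong-↭ f g xs h)

concatMap-↭ : ∀ (g : A → L.List B) {xs ys} → xs ↭ ys → concatMap g xs ↭ concatMap g ys
concatMap-↭ g ↭.refl          = ↭.refl
concatMap-↭ g (prep x p)      = ↭ₚ.++⁺ˡ (g x) (concatMap-↭ g p)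
concatMap-↭ g (swap x y p)    =
  ↭.trans (↭ₚ.shifts (g x) (g y)) (↭ₚ.++⁺ˡ (g y) (↭ₚ.++⁺ˡ (g x) (concatMap-↭ g p)))
concatMap-↭ g (↭.trans p q)   = ↭.trans (concatMap-↭ g p) (concatMap-↭ g q)

concatMap-childPts-∉ : ∀ {d m} (lab : Vec (Fin d) m) x S cs → All (key lab x ≢_) cs →
  concatMap (λ c → childPts lab c (x ∷ S)) cs ≡ concatMap (λ c → childPts lab c S) cs
concatMap-childPts-∉ lab x S []       _ = refl
concatMap-childPts-∉ lab x S (c ∷ cs) (x∉c All.∷ x∉cs) =
  cong₂ _++_ (LP.filter-reject (inChild? lab c) x∉c) (concatMap-childPts-∉ lab x S cs x∉cs)

concatMap-childPts-∈ : ∀ {d m} (lab : Vec (Fin d) m) x S cs → Unique cs → key lab x ∈ cs →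
  concatMap (λ c → childPts lab c (x ∷ S)) cs ↭ x ∷ concatMap (λ c → childPts lab c S) cs
concatMap-childPts-∈ lab x S (c ∷ cs) (c∉cs AllPairs.∷ _) (here x∈c) = ↭.↭-reflexive
  (cong₂ _++_ (LP.filter-accept (inChild? lab c) x∈c)
              (concatMap-childPts-∉ lab x S cs
                 (All.map (λ c≢c′ x∈c′ → c≢c′ (trans (sym x∈c) x∈c′)) c∉cs)))
concatMap-childPts-∈ lab x S (c ∷ cs) (c∉cs AllPairs.∷ unique) (there x∈cs) = begin
  childPts lab c (x ∷ S) ++ concatMap (λ c → childPts lab c (x ∷ S)) cs
    ≡⟨ cong (_++ _) (LP.filter-reject (inChild? lab c) (λ x∈c → All.lookup c∉cs x∈cs (sym x∈c))) ⟩
  childPts lab c S ++ concatMap (λ c → childPts lab c (x ∷ S)) cs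
    ↭⟨ ↭ₚ.++⁺ˡ (childPts lab c S) (concatMap-childPts-∈ lab x S cs unique x∈cs) ⟩
  childPts lab c S ++ x ∷ concatMap (λ c → childPts lab c S) cs
    ↭⟨ ↭ₚ.shift x (childPts lab c S) _ ⟩
  x ∷ childPts lab c S ++ concatMap (λ c → childPts lab c S) cs ∎
  where open ↭.PermutationReasoning

children-partition : ∀ {d m} (lab : Vec (Fin d) m) cs → Unique cs → (∀ x → key lab x ∈ cs) → ∀ S →
  concatMap (λ c → childPts lab c S) cs ↭ S
children-partition lab cs unique complete []      =
  ↭.↭-reflexive (concatMap-[] (λ c → childPts lab c []) cs (λ c → refl))
children-partition lab cs unique complete (x ∷ S) = ↭.trans
  (concatMap-childPts-∈ lab x S cs unique (complete x))
  (prep x (children-partition lab cs unique complete S))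

dfs-↭ : ∀ {d j r} (t : QT d j r) S σ → DFSOrder t S σ → σ ↭ S
dfs-↭ leaf S σ σ≡S = ↭.↭-reflexive σ≡S
dfs-↭ {j = j} (node lab ch) S σ (ord , ord↭ , f , dfs , refl) = begin
  concatMap f ord
    ↭⟨ concatMap-cong-↭ f Sc ord (λ c → dfs-↭ (ch c) (Sc c) (f c) (dfs c)) ⟩
  concatMap Sc ord
    ↭⟨ concatMap-↭ Sc ord↭ ⟩
  concatMap Sc (allVecs (2 ^ j))
    ↭⟨ children-partition lab (allVecs (2 ^ j)) (allVecs-unique (2 ^ j))
                          (λ x → allVecs-complete (2 ^ j) (key lab x)) S ⟩
  S ∎
  where
  open ↭.PermutationReasoning
  Sc = λ c → childPts lab c S

gatedSum-open : ∀ {d} (ps : L.List (L.List (Pt d) × L.List (Pt d))) → 2 N.≤ length ps →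
  gatedSum ps ≡ sumOf avgPair ps
gatedSum-open (_ ∷ _ ∷ _) _         = refl
gatedSum-open (_ ∷ [])    (s≤s ())

length-filter≤length-concatMap : ∀ {P : A → Set} (P? : ∀ x → Dec (P x)) (g : A → L.List B) xs →
  (∀ x → P x → 1 N.≤ length (g x)) → length (filter P? xs) N.≤ length (concatMap g xs)
length-filter≤length-concatMap P? g []       h = z≤n
length-filter≤length-concatMap P? g (x ∷ xs) h with P? x
... | yes px = subst (suc (length (filter P? xs)) N.≤_) (sym (LP.length-++ (g x)))
                 (NP.+-mono-≤ (h x px) (length-filter≤length-concatMap P? g xs h))
... | no _   = subst (length (filter P? xs) N.≤_) (sym (LP.length-++ (g x)))
                 (NP.≤-trans (length-filter≤length-concatMap P? g xs h)
                             (NP.m≤n+m (length (concatMap g xs)) (length (g x))))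

length-pairs-1 : ∀ {d j r} (lab : Vec (Fin d) (2 ^ j)) (ch : Vec Bool (2 ^ j) → QT d (suc j) r) S →
  length (pairs (node lab ch) S 1) ≡ length (occupiedChildren lab S)
length-pairs-1 lab ch S = LP.length-map (λ c → S , childPts lab c S) (occupiedChildren lab S)

occupied-key : ∀ {d m} (lab : Vec (Fin d) m) S {x} → x ∈ S → key lab x ∈ occupiedChildren lab S
occupied-key {m = m} lab S {x} x∈S = ∈-filter⁺ (occupied? lab S) (allVecs-complete m (key lab x))
  (nonempty (∈-filter⁺ (inChild? lab (key lab x)) x∈S refl))
  where
  nonempty : ∀ {xs : L.List (Pt _)} → x ∈ xs → T (not (L.null xs))
  nonempty (here _)  = tt
  nonempty (there _) = tt

pairs-1-nonempty : ∀ {d j r} (t : QT d j (suc r)) S → T (not (L.null S)) → 1 N.≤ length (pairs t S 1)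
pairs-1-nonempty (node lab ch) S@(x ∷ _) _ =
  subst (1 N.≤_) (sym (length-pairs-1 lab ch S)) (∈-length (occupied-key lab S (here refl)))

length-pairs-mono : ∀ {d j r} (t : QT d j r) S i → i N.< r →
  length (pairs t S 1) N.≤ length (pairs t S (suc i))
length-pairs-mono (node lab ch) S zero _ = NP.≤-refl
length-pairs-mono {j = j} (node {r = suc r} lab ch) S (suc i) (s≤s i<r) =
  subst (N._≤ length (concatMap below (allVecs (2 ^ j)))) (sym (length-pairs-1 lab ch S))
    (length-filter≤length-concatMap (occupied? lab S) below (allVecs (2 ^ j))
      (λ c occ → NP.≤-trans (pairs-1-nonempty (ch c) (childPts lab c S) occ)
                            (length-pairs-mono (ch c) (childPts lab c S) i i<r)))
  where below = λ c → pairs (ch c) (childPts lab c S) (suc i)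

module _ {d j r} (lab : Vec (Fin d) (2 ^ j)) (ch : Vec Bool (2 ^ j) → QT d (suc j) r) where

  private
    cs : L.List (Vec Bool (2 ^ j))
    cs = allVecs (2 ^ j)

  ungatedValue-node : ∀ S → ungatedValue (node lab ch) S
    ≡ sumOf (λ c → avg S (childPts lab c S) Q.+ ungatedValue (ch c) (childPts lab c S)) cs
  ungatedValue-node S = begin
    levelSum (node lab ch) S 1 Q.+ sumUpTo (λ i → levelSum (node lab ch) S (suc (suc i))) r
      ≡⟨ cong₂ Q._+_ firstLevel deeperLevels ⟩
    sumOf (λ c → avg S (Sc c)) cs Q.+ sumOf (λ c → ungatedValue (ch c) (Sc c)) cs
      ≡⟨ sumOf-+ (λ c → avg S (Sc c)) (λ c → ungatedValue (ch c) (Sc c)) cs ⟨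
    sumOf (λ c → avg S (Sc c) Q.+ ungatedValue (ch c) (Sc c)) cs ∎
    where
    open ≡-Reasoning
    Sc = λ c → childPts lab c S
    firstLevel : levelSum (node lab ch) S 1 ≡ sumOf (λ c → avg S (Sc c)) cs
    firstLevel = trans (sumOf-map avgPair (λ c → S , Sc c) (occupiedChildren lab S))
      (sumOf-filter (occupied? lab S) (λ c → avg S (Sc c)) cs
        (λ c empty → trans (cong (avg S) (null-≡[] (Sc c) empty)) (avg-empty S)))
    deeperLevels : sumUpTo (λ i → levelSum (node lab ch) S (suc (suc i))) r
                 ≡ sumOf (λ c → ungatedValue (ch c) (Sc c)) cs
    deeperLevels = trans
      (sumUpTo-cong r (λ i _ → sumOf-concatMap avgPair (λ c → pairs (ch c) (Sc c) (suc i)) cs))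
      (sumUpTo-sumOf-comm (λ c i → levelSum (ch c) (Sc c) (suc i)) cs r)

  value-node-single : ∀ S c → occupiedChildren lab S ≡ c ∷ [] →
    value (node lab ch) S ≡ value (ch c) (childPts lab c S)
  value-node-single S c occ = begin
    gatedSum (pairs (node lab ch) S 1) Q.+ sumUpTo (λ i → gatedSum (pairs (node lab ch) S (suc (suc i)))) r
      ≡⟨ cong₂ Q._+_ (cong (λ cs′ → gatedSum (L.map (λ c → S , childPts lab c S) cs′)) occ)
                     (sumUpTo-cong r (λ i _ → cong gatedSum (deeper i))) ⟩
    0ℚ Q.+ value (ch c) (childPts lab c S)
      ≡⟨ QP.+-identityˡ _ ⟩
    value (ch c) (childPts lab c S) ∎
    where
    open ≡-Reasoning
    unoccupied-pairs : ∀ i c′ → ¬ T (not (L.null (childPts lab c′ S))) →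
      pairs (ch c′) (childPts lab c′ S) i ≡ []
    unoccupied-pairs i c′ empty =
      trans (cong (λ S′ → pairs (ch c′) S′ i) (null-≡[] (childPts lab c′ S) empty)) (pairs-[] (ch c′) i)
    deeper : ∀ i → pairs (node lab ch) S (suc (suc i)) ≡ pairs (ch c) (childPts lab c S) (suc i)
    deeper i = begin
      concatMap below cs
        ≡⟨ concatMap-filter (occupied? lab S) below cs (unoccupied-pairs (suc i)) ⟨
      concatMap below (occupiedChildren lab S)
        ≡⟨ cong (concatMap below) occ ⟩
      below c ++ []
        ≡⟨ LP.++-identityʳ (below c) ⟩
      below c ∎
      where below = λ c → pairs (ch c) (childPts lab c S) (suc i)

  value-node-branching : ∀ S → 2 N.≤ length (occupiedChildren lab S) →
    value (node lab ch) S ≡ ungatedValue (node lab ch) S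
  value-node-branching S branching = sumUpTo-cong (suc r) (λ i i<r →
    gatedSum-open (pairs (node lab ch) S (suc i))
      (NP.≤-trans (subst (2 N.≤_) (sym (length-pairs-1 lab ch S)) branching)
                  (length-pairs-mono (node lab ch) S i i<r)))

  dfs-skips-unoccupied : ∀ S ord f → (∀ c → DFSOrder (ch c) (childPts lab c S) (f c)) →
    concatMap f (filter (occupied? lab S) ord) ≡ concatMap f ord
  dfs-skips-unoccupied S ord f dfs = concatMap-filter (occupied? lab S) f ord
    (λ c empty → ↭ₚ.↭-empty-inv (subst (f c ↭_) (null-≡[] (childPts lab c S) empty)
                                        (dfs-↭ (ch c) (childPts lab c S) (f c) (dfs c))))

  excursionCost≤ungatedValue-node : ∀ S σ → DFSOrder (node lab ch) S σ →
    (∀ c σ′ → DFSOrder (ch c) (childPts lab c S) σ′ →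
      excursionCost (childPts lab c S) σ′
        ≤ ungatedValue (ch c) (childPts lab c S) Q.+ ungatedValue (ch c) (childPts lab c S)) →
    excursionCost S σ ≤ ungatedValue (node lab ch) S Q.+ ungatedValue (node lab ch) S
  excursionCost≤ungatedValue-node [] σ dfs IH with ↭ₚ.↭-empty-inv (dfs-↭ (node lab ch) [] σ dfs)
  ... | refl = QP.+-mono-≤ (ungatedValue-nonneg (node lab ch) []) (ungatedValue-nonneg (node lab ch) [])
  excursionCost≤ungatedValue-node S@(_ ∷ _) σ (ord , ord↭ , f , dfsᶜ , refl) IH = begin
    excursionCost S (concatMap f ord)      ≤⟨ excursionCost-concatMap S (s≤s z≤n) f ord ⟩
    sumOf (excursionCost S ∘ f) ord        ≤⟨ sumOf-mono ord child-bound ⟩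
    sumOf (λ c → g c Q.+ g c) ord          ≡⟨ sumOf-+ g g ord ⟩
    sumOf g ord Q.+ sumOf g ord            ≡⟨ cong₂ Q._+_ (sumOf-↭ g ord↭) (sumOf-↭ g ord↭) ⟩
    sumOf g cs Q.+ sumOf g cs              ≡⟨ cong₂ Q._+_ (ungatedValue-node S) (ungatedValue-node S) ⟨
    ungatedValue (node lab ch) S Q.+ ungatedValue (node lab ch) S ∎
    where
    open QP.≤-Reasoning
    Sc = λ c → childPts lab c S
    a = λ c → avg S (Sc c)
    w = λ c → ungatedValue (ch c) (Sc c)
    g = λ c → a c Q.+ w c
    child-bound : ∀ c → excursionCost S (f c) ≤ g c Q.+ g c
    child-bound c = begin
      excursionCost S (f c)
        ≤⟨ excursionCost-shift S (Sc c) (f c) (s≤s z≤n)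
             (↭ₚ.∈-resp-↭ (dfs-↭ (ch c) (Sc c) (f c) (dfsᶜ c))) ⟩
      (a c Q.+ a c) Q.+ excursionCost (Sc c) (f c)
        ≤⟨ QP.+-monoʳ-≤ (a c Q.+ a c) (IH c (f c) (dfsᶜ c)) ⟩
      (a c Q.+ a c) Q.+ (w c Q.+ w c)
        ≡⟨ ℚ+.interchange (a c) (a c) (w c) (w c) ⟩
      g c Q.+ g c ∎

  pathCost≤value-node : ∀ S σ → DFSOrder (node lab ch) S σ →
    (∀ c σ′ → DFSOrder (ch c) (childPts lab c S) σ′ →
      fromℕ (pathCost σ′) ≤ value (ch c) (childPts lab c S) Q.+ value (ch c) (childPts lab c S)) →
    excursionCost S σ ≤ ungatedValue (node lab ch) S Q.+ ungatedValue (node lab ch) S →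
    fromℕ (pathCost σ) ≤ value (node lab ch) S Q.+ value (node lab ch) S
  pathCost≤value-node S σ (ord , ord↭ , f , dfsᶜ , refl) IH excursion≤ =
    by-occupied (occupiedChildren lab S) refl
    where
    V = value (node lab ch) S
    visited↭ : ∀ {cs′} → occupiedChildren lab S ≡ cs′ → filter (occupied? lab S) ord ↭ cs′
    visited↭ occ = subst (filter (occupied? lab S) ord ↭_) occ (↭ₚ.filter-↭ (occupied? lab S) ord↭)
    none-visited : occupiedChildren lab S ≡ [] → concatMap f ord ≡ []
    none-visited occ = trans (sym (dfs-skips-unoccupied S ord f dfsᶜ))
      (cong (concatMap f) (↭ₚ.↭-empty-inv (visited↭ occ)))
    one-visited : ∀ {c} → occupiedChildren lab S ≡ c ∷ [] → concatMap f ord ≡ f c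
    one-visited {c} occ = trans (sym (dfs-skips-unoccupied S ord f dfsᶜ))
      (trans (cong (concatMap f) (↭ₚ.↭-singleton-inv (visited↭ occ))) (LP.++-identityʳ (f c)))
    by-occupied : ∀ cs′ → occupiedChildren lab S ≡ cs′ → fromℕ (pathCost (concatMap f ord)) ≤ V Q.+ V
    by-occupied [] occ rewrite none-visited occ =
      QP.+-mono-≤ (value-nonneg (node lab ch) S) (value-nonneg (node lab ch) S)
    by-occupied (c ∷ []) occ rewrite one-visited occ | value-node-single S c occ = IH c (f c) (dfsᶜ c)
    by-occupied (_ ∷ _ ∷ _) occ
      rewrite value-node-branching S (subst (λ cs′ → 2 N.≤ length cs′) (sym occ) (s≤s (s≤s z≤n))) =
      QP.≤-trans (pathCost≤excursionCost S (concatMap f ord)) excursion≤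

excursionCost≤ungatedValue : ∀ {d j r} (t : QT d j r) S → Admissible t S → ∀ σ → DFSOrder t S σ →
  excursionCost S σ ≤ ungatedValue t S Q.+ ungatedValue t S
excursionCost≤ungatedValue leaf          S adm σ refl = excursionCost-homogeneous S adm
excursionCost≤ungatedValue (node lab ch) S adm σ dfs  = excursionCost≤ungatedValue-node lab ch S σ dfs
  (λ c → excursionCost≤ungatedValue (ch c) (childPts lab c S) (admissible-child lab ch S adm c))

pathCost≤value : ∀ {d j r} (t : QT d j r) S → Admissible t S → ∀ σ → DFSOrder t S σ →
  fromℕ (pathCost σ) ≤ value t S Q.+ value t S
pathCost≤value {j = j} leaf S adm σ dfs =
  QP.≤-trans (pathCost≤excursionCost S σ) (excursionCost≤ungatedValue (leaf {j = j}) S adm σ dfs)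
pathCost≤value (node lab ch) S adm σ dfs = pathCost≤value-node lab ch S σ dfs
  (λ c → pathCost≤value (ch c) (childPts lab c S) (admissible-child lab ch S adm c))
  (excursionCost≤ungatedValue (node lab ch) S adm σ dfs)

pathEdges-endpoints : ∀ {d} (σ : L.List (Pt d)) →
  All (λ e → (proj₁ e ∈ σ) × (proj₂ e ∈ σ)) (pathEdges σ)
pathEdges-endpoints []           = All.[]
pathEdges-endpoints (x ∷ [])     = All.[]
pathEdges-endpoints (x ∷ y ∷ ys) = (here refl , there (here refl))
  All.∷ All.map (λ { (a∈ , b∈) → there a∈ , there b∈ }) (pathEdges-endpoints (y ∷ ys))

length-pathEdges : ∀ {d} (σ : L.List (Pt d)) → length (pathEdges σ) ≡ length σ N.∸ 1
length-pathEdges []           = refl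
length-pathEdges (x ∷ [])     = refl
length-pathEdges (x ∷ y ∷ ys) = cong suc (length-pathEdges (y ∷ ys))

Adj-sym : ∀ {d} {E : Edges d} {a b} → Adj E a b → Adj E b a
Adj-sym (inj₁ ab∈) = inj₂ ab∈
Adj-sym (inj₂ ba∈) = inj₁ ba∈

Star-Adj-∷ : ∀ {d} {E : Edges d} e {a b} → Star (Adj E) a b → Star (Adj (e ∷ E)) a b
Star-Adj-∷ e = Star.gmap id (Sum.map there there)

pathEdges-reach-head : ∀ {d} (x : Pt d) xs {a} → a ∈ x ∷ xs → Star (Adj (pathEdges (x ∷ xs))) a x
pathEdges-reach-head x xs       (here refl) = ε
pathEdges-reach-head x (y ∷ ys) (there a∈)  =
  Star-Adj-∷ (x , y) (pathEdges-reach-head y ys a∈) ◅◅ (inj₂ (here refl) ◅ ε)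

pathEdges-connected : ∀ {d} (σ : L.List (Pt d)) {a b} → a ∈ σ → b ∈ σ → Star (Adj (pathEdges σ)) a b
pathEdges-connected (x ∷ xs) a∈ b∈ =
  pathEdges-reach-head x xs a∈ ◅◅ Star.reverse Adj-sym (pathEdges-reach-head x xs b∈)

pathEdges-spanning : ∀ {d} (X σ : L.List (Pt d)) → σ ↭ X → IsSpanningTree X (pathEdges σ)
pathEdges-spanning X σ σ↭X =
  All.map (λ { (a∈ , b∈) → ↭ₚ.∈-resp-↭ σ↭X a∈ , ↭ₚ.∈-resp-↭ σ↭X b∈ }) (pathEdges-endpoints σ) ,
  trans (length-pathEdges σ) (cong (N._∸ 1) (↭ₚ.↭-length σ↭X)) ,
  λ a∈ b∈ → pathEdges-connected σ (↭ₚ.∈-resp-↭ X↭σ a∈) (↭ₚ.∈-resp-↭ X↭σ b∈)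
  where X↭σ = ↭.↭-sym σ↭X

lemma3p10 : (k : ℕ) (T : Quadtree k) → WellLabelled T →
    (X : List (Pt (2 ^ k))) → Unique X →
    (G : Edges (2 ^ k)) → InGT T X G →
    (m : ℕ) → IsMSTCost X m →
    ((+ Cost G) / 2 ≤ Value T X) × ((+ m) / 2 ≤ (+ Cost G) / 2)
lemma3p10 k T wl X _ G (σ , dfs , refl) m (_ , mst-minimal) = cost≤value , mst≤cost
  where
  cost≤value : frac (pathCost σ) 1 ≤ Value T X
  cost≤value = subst (frac (pathCost σ) 1 ≤_) (sym (Value≡value T X))
    (half-≤ (pathCost σ) (pathCost≤value T X (wellLabelled⇒admissible T wl X) σ dfs))
  mst≤cost : frac m 1 ≤ frac (pathCost σ) 1
  mst≤cost = frac-≤ m 1 (pathCost σ) 1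
    (NP.*-monoˡ-≤ 2 (mst-minimal (pathEdges σ) (pathEdges-spanning X σ (dfs-↭ T X σ dfs))))
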